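{- Let $n\ge1$, $m\ge1$ and let $\mathcal{B}$ be a Boolean algebra with $2^m$ elements. Then $D^{\mathcal{B}}_n$ has exactly $(n+1)^m$ elements and $Boo^{\mathcal{B}}_n$ has exactly $2^m$ elements.
   Context: For a Boolean algebra $\mathcal{B}$ and $n\ge1$, $B^{\mathcal{B}}_n=\{z\in|\mathcal{B}|^{n+1}: (\bigwedge_{i=1}^k z_{[i]})\vee z_{[k+1]}=1 \text{ for all } 1\le k\le n\}$, where $z_{[i]}$ is the $i$-th coordinate of $z$; $D^{\mathcal{B}}_n=\{z\in B^{\mathcal{B}}_n: z_{[1]}=1\}$; $Boo^{\mathcal{B}}_n=\{z\in B^{\mathcal{B}}_n: z_{[1]}\wedge z_{[2]}=0\}$. -}

module Defs where

open import Level using (_⊔_)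
open import Data.Nat using (ℕ; zero; suc; _≤_; s≤s; z≤n)
open import Data.Fin using (Fin; zero; suc; inject₁)
open import Data.Product using (Σ; _×_; proj₁)
open import Function using (_∘_)
open import Function.Bundles using (Bijection)
open import Relation.Binary.Bundles using (Setoid)
import Relation.Binary.PropositionalEquality as ≡
import Relation.Binary.Construct.On as On
open import Algebra.Lattice.Bundles using (BooleanAlgebra)
import Data.Vec.Functional.Relation.Binary.Equality.Setoid as VecEq

HasCard : ∀ {a ℓ} → Setoid a ℓ → ℕ → Set (a ⊔ ℓ)
HasCard S k = Bijection (≡.setoid (Fin k)) S

module _ {c ℓ} (𝔹 : BooleanAlgebra c ℓ) where
  open BooleanAlgebra 𝔹

  -- Elements of |B|^(n+1), as functions Fin (n+1) → |B|.
  -- Coordinate z_[i] (1 ≤ i ≤ n+1) is  z (i-1).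
  Tuple : ℕ → Set c
  Tuple n = Fin (suc n) → Carrier

  -- prefixMeet z j = z_[1] ∧ ... ∧ z_[j+1]
  prefixMeet : ∀ {n} → Tuple n → Fin (suc n) → Carrier
  prefixMeet z zero = z zero
  prefixMeet {suc n} z (suc j) = prefixMeet {n} (z ∘ inject₁) j ∧ z (suc j)

  -- z ∈ B_n : for all 1 ≤ k ≤ n, (⋀_{i=1}^k z_[i]) ∨ z_[k+1] = 1.
  -- (k is represented by k' : Fin n with k = k'+1.)
  InB : (n : ℕ) → Tuple n → Set ℓ
  InB n z = (k : Fin n) → (prefixMeet z (inject₁ k) ∨ z (suc k)) ≈ ⊤

  InD : (n : ℕ) → Tuple n → Set ℓ
  InD n z = InB n z × (z zero ≈ ⊤)

  InBoo : (n : ℕ) → 1 ≤ n → Tuple n → Set ℓ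
  InBoo (suc n) (s≤s z≤n) z = InB (suc n) z × ((z zero ∧ z (suc zero)) ≈ ⊥)

  TupleSetoid : ℕ → Setoid c ℓ
  TupleSetoid n = VecEq.≋-setoid setoid (suc n)

  SubSetoid : (n : ℕ) → (Tuple n → Set ℓ) → Setoid (c ⊔ ℓ) ℓ
  SubSetoid n P = On.setoid (TupleSetoid n) (proj₁ {B = P})

  D-setoid : ℕ → Setoid (c ⊔ ℓ) ℓ
  D-setoid n = SubSetoid n (InD n)

  Boo-setoid : (n : ℕ) → 1 ≤ n → Setoid (c ⊔ ℓ) ℓ
  Boo-setoid n h = SubSetoid n (InBoo n h)

-- A finite Boolean algebra is the power set of its atoms: splitting ⊤ by every element
-- in turn and discarding the empty pieces leaves atoms a₁, …, a_t, and recording which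
-- atoms lie below x is an isomorphism 𝔹 ≅ 𝟚ᵗ, so t = m. The conditions defining D_n are
-- lattice equations, hence are checked atom by atom, so D_n over 𝔹 is (D_n over 𝟚)ᵗ.
-- Over 𝟚 a tuple of B_n has at most one coordinate 0; in D_n that coordinate is not the
-- first one, which leaves n + 1 tuples. In Boo_n the coordinates z_[1] and z_[2] are
-- complements, which makes every prefix meet past z_[2] vanish and forces all later
-- coordinates to be 1, so z ↦ z_[1] is a bijection Boo_n → 𝔹.

module Submission where

open import Level using (Level; _⊔_)
open import Data.Nat using (ℕ; zero; suc; _^_; _<_; _≤_; _+_; s≤s; z≤n)
open import Data.Nat.Properties using (<-cmp; <-irrefl; ^-monoʳ-<; +-comm)
open import Data.Fin using (Fin; zero; suc; inject₁; punchIn; finToFun; funToFin; combine; _≟_)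
open import Data.Fin.Properties
  using (finToFun-funToFin; funToFin-finToFin; cantor-schröder-bernstein; punchInᵢ≢i; 2↔Bool)
open import Data.Bool using (Bool; true; false) renaming (_∧_ to _∧ᵇ_; _∨_ to _∨ᵇ_)
open import Data.Bool.Properties using () renaming (∨-zeroʳ to ∨ᵇ-zeroʳ; ∨-∧-booleanAlgebra to 𝟚)
open import Data.Product using (Σ; _×_; _,_; proj₁; proj₂)
open import Data.Sum using (_⊎_; inj₁; inj₂; [_,_]′)
open import Data.List using (List; []; _∷_; foldr; filter; lookup; length)
open import Data.List.Relation.Unary.All as All using (All; []; _∷_)
import Data.List.Relation.Unary.All.Properties as Allₚ
open import Data.List.Relation.Unary.AllPairs using (AllPairs; []; _∷_)
import Data.List.Relation.Unary.AllPairs.Properties as AllPairsₚ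
import Data.Vec.Functional.Relation.Binary.Equality.Setoid as Pointwise
open import Function using (_∘_; const; case_of_; _⇔_; mk⇔; Equivalence)
open import Function.Bundles using (Inverse; Injection)
open import Function.Properties.Inverse using (Inverse⇒Bijection; Inverse⇒Injection)
open import Function.Properties.Bijection using (Bijection⇒Inverse)
import Function.Construct.Composition as Compose
import Function.Construct.Symmetry as Symmetry
import Function.Consequences.Setoid as Consequences
open import Relation.Nullary using (Dec; ¬?; yes; no)
open import Relation.Nullary.Decidable using (map′)
open import Relation.Nullary.Negation using (contradiction)
open import Relation.Binary using (Setoid; Symmetric; Rel; Decidable; tri<; tri≈; tri>)
open import Relation.Binary.PropositionalEquality as ≡ using (_≡_; _≢_; _≗_)
open import Algebra.Bundles using (CommutativeMonoid; CommutativeSemiring)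
open import Algebra.Lattice.Bundles using (BooleanAlgebra)
open import Defs

private
  variable
    a b c c′ ℓ ℓ′ ℓ₁ ℓ₂ : Level

-- Finite setoids

mkInverse : {S : Setoid a ℓ₁} {T : Setoid b ℓ₂} →
  let module S = Setoid S; module T = Setoid T in
  (to : S.Carrier → T.Carrier) (from : T.Carrier → S.Carrier) →
  (∀ {x y} → x S.≈ y → to x T.≈ to y) → (∀ {x y} → x T.≈ y → from x S.≈ from y) →
  (∀ y → to (from y) T.≈ y) → (∀ x → from (to x) S.≈ x) → Inverse S T
mkInverse {S = S} {T} to from to-cong from-cong to∘from from∘to = record
  { to        = to
  ; from      = from
  ; to-cong   = to-cong
  ; from-cong = from-cong
  ; inverse   = strictlyInverseˡ⇒inverseˡ to-cong to∘from
              , strictlyInverseʳ⇒inverseʳ from-cong from∘to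
  }
  where open Consequences S T

HasCard-↔ : {S : Setoid a ℓ₁} {T : Setoid b ℓ₂} {k : ℕ} → HasCard S k → Inverse S T → HasCard T k
HasCard-↔ card S↔T = Compose.bijection card (Inverse⇒Bijection S↔T)

HasCard-unique : {S : Setoid a ℓ} {m n : ℕ} → HasCard S m → HasCard S n → m ≡ n
HasCard-unique {m = m} {n} cardₘ cardₙ = cantor-schröder-bernstein
  (Injection.injective (Inverse⇒Injection m↔n))
  (Injection.injective (Inverse⇒Injection (Symmetry.inverse m↔n)))
  where
  m↔n : Inverse (≡.setoid (Fin m)) (≡.setoid (Fin n))
  m↔n = Compose.inverse (Bijection⇒Inverse cardₘ) (Symmetry.inverse (Bijection⇒Inverse cardₙ))

funToFin-cong : ∀ {m n} {f g : Fin m → Fin n} → f ≗ g → funToFin f ≡ funToFin g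
funToFin-cong {zero}  f≗g = ≡.refl
funToFin-cong {suc m} f≗g = ≡.cong₂ combine (f≗g zero) (funToFin-cong (f≗g ∘ suc))

HasCard-^ : {S : Setoid a ℓ} {k : ℕ} (t : ℕ) → HasCard S k → HasCard (Pointwise.≋-setoid S t) (k ^ t)
HasCard-^ {S = S} {k} t card = Inverse⇒Bijection (mkInverse to from to-cong from-cong to∘from from∘to)
  where
  module S = Setoid S
  module I = Inverse (Bijection⇒Inverse card)
  to : Fin (k ^ t) → Fin t → S.Carrier
  to c = I.to ∘ finToFun c
  from : (Fin t → S.Carrier) → Fin (k ^ t)
  from f = funToFin (I.from ∘ f)
  to-cong : ∀ {c d} → c ≡ d → ∀ i → to c i S.≈ to d i
  to-cong ≡.refl i = S.refl
  from-cong : ∀ {f g} → (∀ i → f i S.≈ g i) → from f ≡ from g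
  from-cong f≋g = funToFin-cong {t} (I.from-cong ∘ f≋g)
  to∘from : ∀ f i → to (from f) i S.≈ f i
  to∘from f i = S.trans (S.reflexive (≡.cong I.to (finToFun-funToFin (I.from ∘ f) i))) (I.strictlyInverseˡ (f i))
  from∘to : ∀ c → from (to c) ≡ c
  from∘to c = ≡.trans (funToFin-cong {t} (I.strictlyInverseʳ ∘ finToFun c)) (funToFin-finToFin {t} c)

HasCard-≟ : {S : Setoid a ℓ} {k : ℕ} → HasCard S k → Decidable (Setoid._≈_ S)
HasCard-≟ {S = S} card x y = map′ from-injective I.from-cong (I.from x ≟ I.from y)
  where
  module S = Setoid S
  module I = Inverse (Bijection⇒Inverse card)
  from-injective : I.from x ≡ I.from y → x S.≈ y
  from-injective eq = S.trans (S.sym (I.strictlyInverseˡ x)) (S.trans (I.to-cong eq) (I.strictlyInverseˡ y))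

^-injectiveʳ : ∀ k {m n} → 1 < k → k ^ m ≡ k ^ n → m ≡ n
^-injectiveʳ k {m} {n} 1<k kᵐ≡kⁿ with <-cmp m n
... | tri< m<n _ _ = contradiction (^-monoʳ-< k 1<k m<n) (<-irrefl kᵐ≡kⁿ)
... | tri≈ _ m≡n _ = m≡n
... | tri> _ _ m>n = contradiction (^-monoʳ-< k 1<k m>n) (<-irrefl (≡.sym kᵐ≡kⁿ))

All-lookup : ∀ {A : Set a} {P : A → Set ℓ} {xs : List A} → All P xs → ∀ i → P (lookup xs i)
All-lookup (px ∷ _)   zero    = px
All-lookup (_  ∷ pxs) (suc i) = All-lookup pxs i

AllPairs-lookup : ∀ {A : Set a} {R : Rel A ℓ} → Symmetric R → ∀ {xs} → AllPairs R xs →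
  ∀ {i j} → i ≢ j → R (lookup xs i) (lookup xs j)
AllPairs-lookup sym (_ ∷ _)    {zero}  {zero}  0≢0 = contradiction ≡.refl 0≢0
AllPairs-lookup sym (Rx ∷ _)   {zero}  {suc j} _   = All-lookup Rx j
AllPairs-lookup sym (Rx ∷ _)   {suc i} {zero}  _   = sym (All-lookup Rx i)
AllPairs-lookup sym (_ ∷ Rxs)  {suc i} {suc j} i≢j = AllPairs-lookup sym Rxs (i≢j ∘ ≡.cong suc)

module _ (M : CommutativeMonoid c ℓ) where
  open CommutativeMonoid M renaming (ε to 0#)
  open import Algebra.Properties.CommutativeMonoid.Sum M using (sum; sum-remove; sum-cong-≋; sum-replicate-zero)

  sum-single : ∀ {n} (f : Fin n → Carrier) k → (∀ j → j ≢ k → f j ≈ 0#) → sum f ≈ f k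
  sum-single {suc n} f k others = begin
    sum f                      ≈⟨ sum-remove f ⟩
    f k ∙ sum (f ∘ punchIn k)  ≈⟨ ∙-congˡ (sum-cong-≋ (λ j → others _ (punchInᵢ≢i k j))) ⟩
    f k ∙ sum {n} (λ _ → 0#)   ≈⟨ ∙-congˡ (sum-replicate-zero n) ⟩
    f k ∙ 0#                   ≈⟨ identityʳ (f k) ⟩
    f k                        ∎
    where open import Relation.Binary.Reasoning.Setoid setoid

-- Tuples over a Boolean algebra

module _ (𝔹 : BooleanAlgebra c ℓ) where
  open BooleanAlgebra 𝔹
  open import Algebra.Lattice.Properties.BooleanAlgebra 𝔹
  open import Relation.Binary.Reasoning.Setoid setoid

  ¬-unique : ∀ {x y} → x ∧ y ≈ ⊥ → x ∨ y ≈ ⊤ → ¬ x ≈ y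
  ¬-unique {x} {y} x∧y≈⊥ x∨y≈⊤ = begin
    ¬ x                ≈⟨ ∧-identityʳ (¬ x) ⟨
    ¬ x ∧ ⊤            ≈⟨ ∧-congˡ x∨y≈⊤ ⟨
    ¬ x ∧ (x ∨ y)      ≈⟨ ∧-distribˡ-∨ (¬ x) x y ⟩
    ¬ x ∧ x ∨ ¬ x ∧ y  ≈⟨ ∨-congʳ (trans (∧-complementˡ x) (sym x∧y≈⊥)) ⟩
    x ∧ y ∨ ¬ x ∧ y    ≈⟨ ∧-distribʳ-∨ y x (¬ x) ⟨
    (x ∨ ¬ x) ∧ y      ≈⟨ ∧-congʳ (∨-complementʳ x) ⟩
    ⊤ ∧ y              ≈⟨ ∧-identityˡ y ⟩
    y                  ∎

  prefixMeet-cong : ∀ {n} {z w : Tuple 𝔹 n} → (∀ i → z i ≈ w i) → ∀ j → prefixMeet 𝔹 z j ≈ prefixMeet 𝔹 w j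
  prefixMeet-cong         z≋w zero    = z≋w zero
  prefixMeet-cong {suc n} z≋w (suc j) = ∧-cong (prefixMeet-cong (z≋w ∘ inject₁) j) (z≋w (suc j))

  InD-cong : ∀ {n} {z w : Tuple 𝔹 n} → (∀ i → z i ≈ w i) → InD 𝔹 n z → InD 𝔹 n w
  InD-cong z≋w (z∈B , z₀≈⊤) =
      (λ k → trans (sym (∨-cong (prefixMeet-cong z≋w (inject₁ k)) (z≋w (suc k)))) (z∈B k))
    , trans (sym (z≋w zero)) z₀≈⊤

  prefixMeet-suc : ∀ {n} (z : Tuple 𝔹 (suc n)) j → prefixMeet 𝔹 z (suc j) ≈ z zero ∧ prefixMeet 𝔹 (z ∘ suc) j
  prefixMeet-suc         z zero    = refl
  prefixMeet-suc {suc n} z (suc j) = trans (∧-congʳ (prefixMeet-suc (z ∘ inject₁) j)) (∧-assoc _ _ _)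

  InB-suc : ∀ {n} {z : Tuple 𝔹 (suc n)} → z zero ≈ ⊤ → InB 𝔹 (suc n) z ⇔ InB 𝔹 n (z ∘ suc)
  InB-suc {z = z} z₀≈⊤ = mk⇔
    (λ z∈B k → trans (∨-congʳ (sym (drop-head (inject₁ k)))) (z∈B (suc k)))
    λ { tail∈B zero    → trans (∨-congʳ z₀≈⊤) (∨-zeroˡ _)
      ; tail∈B (suc k) → trans (∨-congʳ (drop-head (inject₁ k))) (tail∈B k) }
    where
    drop-head : ∀ j → prefixMeet 𝔹 z (suc j) ≈ prefixMeet 𝔹 (z ∘ suc) j
    drop-head j = trans (prefixMeet-suc z j) (trans (∧-congʳ z₀≈⊤) (∧-identityˡ _))

  prefixMeet-⊥ : ∀ {n} (z : Tuple 𝔹 (suc n)) → z zero ∧ z (suc zero) ≈ ⊥ → ∀ j → prefixMeet 𝔹 z (suc j) ≈ ⊥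
  prefixMeet-⊥         z z₀∧z₁≈⊥ zero    = z₀∧z₁≈⊥
  prefixMeet-⊥ {suc n} z z₀∧z₁≈⊥ (suc j) = trans (∧-congʳ (prefixMeet-⊥ (z ∘ inject₁) z₀∧z₁≈⊥ j)) (∧-zeroˡ _)

  booTuple : ∀ n → Carrier → Tuple 𝔹 (suc n)
  booTuple n x zero          = x
  booTuple n x (suc zero)    = ¬ x
  booTuple n x (suc (suc _)) = ⊤

  booTuple-InBoo : ∀ n x → InBoo 𝔹 (suc n) (s≤s z≤n) (booTuple n x)
  booTuple-InBoo n x = (λ { zero → ∨-complementʳ x ; (suc k) → ∨-zeroʳ _ }) , ∧-complementʳ x

  booTuple-head : ∀ n {z} → InBoo 𝔹 (suc n) (s≤s z≤n) z → ∀ i → booTuple n (z zero) i ≈ z i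
  booTuple-head n     _               zero          = refl
  booTuple-head n     (z∈B , z₀∧z₁≈⊥) (suc zero)    = ¬-unique z₀∧z₁≈⊥ (z∈B zero)
  booTuple-head n {z} (z∈B , z₀∧z₁≈⊥) (suc (suc i)) = begin
    ⊤                                                   ≈⟨ z∈B (suc i) ⟨
    prefixMeet 𝔹 z (suc (inject₁ i)) ∨ z (suc (suc i))  ≈⟨ ∨-congʳ (prefixMeet-⊥ z z₀∧z₁≈⊥ (inject₁ i)) ⟩
    ⊥ ∨ z (suc (suc i))                                 ≈⟨ ∨-identityˡ _ ⟩
    z (suc (suc i))                                     ∎

  Boo↔ : ∀ n → Inverse setoid (Boo-setoid 𝔹 (suc n) (s≤s z≤n))
  Boo↔ n = mkInverse (λ x → booTuple n x , booTuple-InBoo n x) (λ z → proj₁ z zero)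
    booTuple-cong (λ z≋w → z≋w zero) (λ z → booTuple-head n (proj₂ z)) (λ _ → refl)
    where
    booTuple-cong : ∀ {x y} → x ≈ y → ∀ i → booTuple n x i ≈ booTuple n y i
    booTuple-cong x≈y zero          = x≈y
    booTuple-cong x≈y (suc zero)    = ¬-cong x≈y
    booTuple-cong x≈y (suc (suc _)) = refl

module _ (𝔸 : BooleanAlgebra c ℓ) (𝔹 : BooleanAlgebra c′ ℓ′) where
  private
    module 𝔸 = BooleanAlgebra 𝔸
    module 𝔹 = BooleanAlgebra 𝔹

  prefixMeet-homo : ∀ {f : 𝔸.Carrier → 𝔹.Carrier} → (∀ x y → f (x 𝔸.∧ y) 𝔹.≈ f x 𝔹.∧ f y) →
    ∀ {n} (z : Tuple 𝔸 n) j → f (prefixMeet 𝔸 z j) 𝔹.≈ prefixMeet 𝔹 (f ∘ z) j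
  prefixMeet-homo ∧-homo z zero = 𝔹.refl
  prefixMeet-homo {f} ∧-homo {suc n} z (suc j) =
    𝔹.trans (∧-homo _ _) (𝔹.∧-congʳ (prefixMeet-homo {f} ∧-homo (z ∘ inject₁) j))

-- Tuples over 𝟚

falseAt : ∀ {m} → Fin m → Fin m → Bool
falseAt zero    zero    = false
falseAt zero    (suc _) = true
falseAt (suc _) zero    = true
falseAt (suc c) (suc i) = falseAt c i

falseAt-self : ∀ {m} (c : Fin m) → falseAt c c ≡ false
falseAt-self zero    = ≡.refl
falseAt-self (suc c) = falseAt-self c

falseAt-false : ∀ {m} {c i : Fin m} → falseAt c i ≡ false → i ≡ c
falseAt-false {c = zero}  {zero}  _ = ≡.refl
falseAt-false {c = suc c} {suc i} e = ≡.cong suc (falseAt-false e)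

falseAt-InB : ∀ n (c : Fin (suc n)) → InB 𝟚 n (falseAt c)
falseAt-InB n       zero    k = ∨ᵇ-zeroʳ _
falseAt-InB (suc n) (suc c)   = Equivalence.from (InB-suc 𝟚 ≡.refl) (falseAt-InB n c)

prefixMeet-false : ∀ {n} (v : Tuple 𝟚 n) → v zero ≡ false → ∀ j → prefixMeet 𝟚 v j ≡ false
prefixMeet-false         v v₀≡false zero    = v₀≡false
prefixMeet-false {suc n} v v₀≡false (suc j) = ≡.trans (prefixMeet-suc 𝟚 v j) (≡.cong (_∧ᵇ prefixMeet 𝟚 (v ∘ suc) j) v₀≡false)

InB-𝟚-shape : ∀ n {v : Tuple 𝟚 n} → InB 𝟚 n v →
  (∀ i → v i ≡ true) ⊎ Σ (Fin (suc n)) λ c → ∀ i → v i ≡ falseAt c i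
InB-𝟚-shape n {v} v∈B with v zero in v₀≡
... | false = inj₂ (zero , λ { zero → v₀≡ ; (suc i) → tail-true i })
  where
  tail-true : ∀ i → v (suc i) ≡ true
  tail-true i = ≡.trans (≡.cong (_∨ᵇ v (suc i)) (≡.sym (prefixMeet-false v v₀≡ (inject₁ i)))) (v∈B i)
InB-𝟚-shape zero    {v} v∈B | true = inj₁ λ { zero → v₀≡ }
InB-𝟚-shape (suc n) {v} v∈B | true with InB-𝟚-shape n (Equivalence.to (InB-suc 𝟚 v₀≡) v∈B)
... | inj₁ tail-true     = inj₁ λ { zero → v₀≡ ; (suc i) → tail-true i }
... | inj₂ (c , tail≡c)  = inj₂ (suc c , λ { zero → v₀≡ ; (suc i) → tail≡c i })

decode : ∀ {n} → Fin (suc n) → Tuple 𝟚 n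
decode zero    = λ _ → true
decode (suc c) = falseAt (suc c)

decode-InD : ∀ {n} (c : Fin (suc n)) → InD 𝟚 n (decode c)
decode-InD zero    = (λ _ → ∨ᵇ-zeroʳ _) , ≡.refl
decode-InD (suc c) = falseAt-InB _ (suc c) , ≡.refl

decode-injective : ∀ {n} {c d : Fin (suc n)} → (∀ i → decode c i ≡ decode d i) → c ≡ d
decode-injective {c = zero}  {zero}  _ = ≡.refl
decode-injective {c = zero}  {suc d} c≋d = case ≡.trans (c≋d (suc d)) (falseAt-self d) of λ ()
decode-injective {c = suc c} {zero}  c≋d = case ≡.trans (≡.sym (c≋d (suc c))) (falseAt-self c) of λ ()
decode-injective {c = suc c} {suc d} c≋d = ≡.cong suc (falseAt-false (≡.trans (≡.sym (c≋d (suc c))) (falseAt-self c)))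

decode-surjective : ∀ {n} {v : Tuple 𝟚 n} → InD 𝟚 n v → Σ (Fin (suc n)) λ c → ∀ i → decode c i ≡ v i
decode-surjective {n} (v∈B , v₀≡true) with InB-𝟚-shape n v∈B
... | inj₁ all-true       = zero , ≡.sym ∘ all-true
... | inj₂ (suc c , v≡c)  = suc c , ≡.sym ∘ v≡c
... | inj₂ (zero , v≡c)   = case ≡.trans (≡.sym v₀≡true) (v≡c zero) of λ ()

D-𝟚-card : ∀ n → HasCard (D-setoid 𝟚 n) (suc n)
D-𝟚-card n = record
  { to        = λ c → decode c , decode-InD c
  ; cong      = λ { ≡.refl _ → ≡.refl }
  ; bijective = decode-injective , λ (_ , v∈D) →
      let c , c≋v = decode-surjective v∈D in c , λ { ≡.refl → c≋v }
  }

-- Atoms of a finite Boolean algebra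

module _ (𝔹 : BooleanAlgebra c ℓ) where
  open BooleanAlgebra 𝔹
  open import Algebra.Lattice.Properties.BooleanAlgebra 𝔹
  open CommutativeSemiring ∨-∧-commutativeSemiring using (+-commutativeMonoid; *-commutativeSemigroup)
  open import Algebra.Properties.CommutativeSemigroup *-commutativeSemigroup using (interchange; xy∙z≈xz∙y)
  open import Algebra.Properties.Semiring.Sum (CommutativeSemiring.semiring ∨-∧-commutativeSemiring)
    using (sum-cong-≋; *-distribˡ-sum) renaming (sum to ⋁)
  open import Relation.Binary.Reasoning.Setoid setoid

  ∧-distribˡ-∧ : ∀ a x y → a ∧ (x ∧ y) ≈ (a ∧ x) ∧ (a ∧ y)
  ∧-distribˡ-∧ a x y = trans (∧-congʳ (sym (∧-idem a))) (interchange a a x y)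

  ⟦_⟧ : Bool → Carrier
  ⟦ true  ⟧ = ⊤
  ⟦ false ⟧ = ⊥

  ⟦⟧-∧ : ∀ a b → ⟦ a ∧ᵇ b ⟧ ≈ ⟦ a ⟧ ∧ ⟦ b ⟧
  ⟦⟧-∧ true  b = sym (∧-identityˡ ⟦ b ⟧)
  ⟦⟧-∧ false b = sym (∧-zeroˡ ⟦ b ⟧)

  ⟦⟧-∨ : ∀ a b → ⟦ a ∨ᵇ b ⟧ ≈ ⟦ a ⟧ ∨ ⟦ b ⟧
  ⟦⟧-∨ true  b = sym (∨-zeroˡ ⟦ b ⟧)
  ⟦⟧-∨ false b = sym (∨-identityˡ ⟦ b ⟧)

  ∧⟦⟧-injective : ∀ {p} → p ≉ ⊥ → ∀ {a b} → p ∧ ⟦ a ⟧ ≈ p ∧ ⟦ b ⟧ → a ≡ b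
  ∧⟦⟧-injective p≉⊥ {true}  {true}  _ = ≡.refl
  ∧⟦⟧-injective p≉⊥ {false} {false} _ = ≡.refl
  ∧⟦⟧-injective p≉⊥ {true}  {false} e = contradiction (trans (sym (∧-identityʳ _)) (trans e (∧-zeroʳ _))) p≉⊥
  ∧⟦⟧-injective p≉⊥ {false} {true}  e = contradiction (trans (sym (∧-identityʳ _)) (trans (sym e) (∧-zeroʳ _))) p≉⊥

  Undivided : Carrier → Carrier → Set ℓ
  Undivided e p = p ∧ e ≈ p ⊎ p ∧ e ≈ ⊥

  Disjoint : Carrier → Carrier → Set ℓ
  Disjoint p q = p ∧ q ≈ ⊥

  Hereditary : (Carrier → Set ℓ) → Set (c ⊔ ℓ)
  Hereditary Q = ∀ {p} x → Q p → Q (p ∧ x)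

  undivided-hereditary : ∀ e → Hereditary (Undivided e)
  undivided-hereditary e x (inj₁ p∧e≈p) = inj₁ (trans (xy∙z≈xz∙y _ x e) (∧-congʳ p∧e≈p))
  undivided-hereditary e x (inj₂ p∧e≈⊥) = inj₂ (trans (xy∙z≈xz∙y _ x e) (trans (∧-congʳ p∧e≈⊥) (∧-zeroˡ x)))

  undivided-resp : ∀ {e e′ p} → e ≈ e′ → Undivided e p → Undivided e′ p
  undivided-resp e≈e′ (inj₁ p∧e≈p) = inj₁ (trans (∧-congˡ (sym e≈e′)) p∧e≈p)
  undivided-resp e≈e′ (inj₂ p∧e≈⊥) = inj₂ (trans (∧-congˡ (sym e≈e′)) p∧e≈⊥)

  disjoint-shrink : ∀ {p q} x → Disjoint p q → Disjoint (p ∧ x) q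
  disjoint-shrink {p} {q} x p∧q≈⊥ = trans (xy∙z≈xz∙y p x q) (trans (∧-congʳ p∧q≈⊥) (∧-zeroˡ x))

  disjoint-sym : ∀ {p q} → Disjoint p q → Disjoint q p
  disjoint-sym p∧q≈⊥ = trans (∧-comm _ _) p∧q≈⊥

  ⋁ˡ : List Carrier → Carrier
  ⋁ˡ = foldr _∨_ ⊥

  ⋁ˡ-lookup : ∀ ps → ⋁ˡ ps ≈ ⋁ (lookup ps)
  ⋁ˡ-lookup []       = refl
  ⋁ˡ-lookup (p ∷ ps) = ∨-congˡ (⋁ˡ-lookup ps)

  split : Carrier → List Carrier → List Carrier
  split e []       = []
  split e (p ∷ ps) = p ∧ e ∷ p ∧ ¬ e ∷ split e ps

  split-All : ∀ {Q} → Hereditary Q → ∀ e {ps} → All Q ps → All Q (split e ps)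
  split-All hered e []         = []
  split-All hered e (Qp ∷ Qps) = hered e Qp ∷ hered (¬ e) Qp ∷ split-All hered e Qps

  split-undivided : ∀ e ps → All (Undivided e) (split e ps)
  split-undivided e []       = []
  split-undivided e (p ∷ ps) = inj₁ inside ∷ inj₂ outside ∷ split-undivided e ps
    where
    inside : (p ∧ e) ∧ e ≈ p ∧ e
    inside = trans (∧-assoc p e e) (∧-congˡ (∧-idem e))
    outside : (p ∧ ¬ e) ∧ e ≈ ⊥
    outside = trans (∧-assoc p (¬ e) e) (trans (∧-congˡ (∧-complementˡ e)) (∧-zeroʳ p))

  split-disjoint : ∀ e {ps} → AllPairs Disjoint ps → AllPairs Disjoint (split e ps)
  split-disjoint e         []               = []
  split-disjoint e {p ∷ _} (p⊥ps ∷ ps-disj) =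
      (halves-disjoint ∷ rest e) ∷ rest (¬ e) ∷ split-disjoint e ps-disj
    where
    rest : ∀ x → All (Disjoint (p ∧ x)) (split e _)
    rest x = split-All (λ y → disjoint-sym ∘ disjoint-shrink y ∘ disjoint-sym) e
               (All.map (disjoint-shrink x) p⊥ps)
    halves-disjoint : Disjoint (p ∧ e) (p ∧ ¬ e)
    halves-disjoint = begin
      (p ∧ e) ∧ (p ∧ ¬ e) ≈⟨ interchange p e p (¬ e) ⟩
      (p ∧ p) ∧ (e ∧ ¬ e) ≈⟨ ∧-congˡ (∧-complementʳ e) ⟩
      (p ∧ p) ∧ ⊥         ≈⟨ ∧-zeroʳ _ ⟩
      ⊥                   ∎

  ⋁ˡ-split : ∀ e ps → ⋁ˡ (split e ps) ≈ ⋁ˡ ps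
  ⋁ˡ-split e []       = refl
  ⋁ˡ-split e (p ∷ ps) = begin
    p ∧ e ∨ (p ∧ ¬ e ∨ ⋁ˡ (split e ps)) ≈⟨ ∨-assoc _ _ _ ⟨
    (p ∧ e ∨ p ∧ ¬ e) ∨ ⋁ˡ (split e ps) ≈⟨ ∨-cong (sym (∧-distribˡ-∨ p e (¬ e))) (⋁ˡ-split e ps) ⟩
    p ∧ (e ∨ ¬ e) ∨ ⋁ˡ ps               ≈⟨ ∨-congʳ (trans (∧-congˡ (∨-complementʳ e)) (∧-identityʳ p)) ⟩
    p ∨ ⋁ˡ ps                           ∎

  -- The partition of ⊤ generated by the elements e i (with empty cells).
  cells : ∀ {N} → (Fin N → Carrier) → List Carrier
  cells {zero}  _ = ⊤ ∷ []
  cells {suc N} e = split (e zero) (cells (e ∘ suc))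

  cells-disjoint : ∀ {N} (e : Fin N → Carrier) → AllPairs Disjoint (cells e)
  cells-disjoint {zero}  e = [] ∷ []
  cells-disjoint {suc N} e = split-disjoint (e zero) (cells-disjoint (e ∘ suc))

  cells-cover : ∀ {N} (e : Fin N → Carrier) → ⋁ˡ (cells e) ≈ ⊤
  cells-cover {zero}  e = ∨-identityʳ ⊤
  cells-cover {suc N} e = trans (⋁ˡ-split (e zero) (cells (e ∘ suc))) (cells-cover (e ∘ suc))

  cells-undivided : ∀ {N} (e : Fin N → Carrier) i → All (Undivided (e i)) (cells e)
  cells-undivided e zero    = split-undivided (e zero) _
  cells-undivided e (suc i) = split-All (undivided-hereditary (e (suc i))) (e zero) (cells-undivided (e ∘ suc) i)

  module _ (_≈?_ : Decidable _≈_) where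

    nonzero? : ∀ p → Dec (p ≉ ⊥)
    nonzero? p = ¬? (p ≈? ⊥)

    ⋁ˡ-nonzero : ∀ ps → ⋁ˡ (filter nonzero? ps) ≈ ⋁ˡ ps
    ⋁ˡ-nonzero []       = refl
    ⋁ˡ-nonzero (p ∷ ps) with p ≈? ⊥
    ... | no _    = ∨-congˡ (⋁ˡ-nonzero ps)
    ... | yes p≈⊥ = trans (⋁ˡ-nonzero ps) (trans (sym (∨-identityˡ _)) (∨-congʳ (sym p≈⊥)))

  record AtomicPartition (t : ℕ) : Set (c ⊔ ℓ) where
    field
      atom      : Fin t → Carrier
      nonzero   : ∀ k → atom k ≉ ⊥
      disjoint  : ∀ {j k} → j ≢ k → atom j ∧ atom k ≈ ⊥
      covering  : ⋁ atom ≈ ⊤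
      undivided : ∀ k x → Undivided x (atom k)

  finite⇒atomicPartition : ∀ {N} → HasCard setoid N → Σ ℕ AtomicPartition
  finite⇒atomicPartition card = length atoms , record
    { atom      = lookup atoms
    ; nonzero   = All-lookup (Allₚ.all-filter (nonzero? _≈?_) (cells I.to))
    ; disjoint  = AllPairs-lookup disjoint-sym (AllPairsₚ.filter⁺ (nonzero? _≈?_) (cells-disjoint I.to))
    ; covering  = trans (sym (⋁ˡ-lookup atoms)) (trans (⋁ˡ-nonzero _≈?_ (cells I.to)) (cells-cover I.to))
    ; undivided = λ k x → undivided-resp (I.strictlyInverseˡ x)
                    (All-lookup (Allₚ.filter⁺ (nonzero? _≈?_) (cells-undivided I.to (I.from x))) k)
    }
    where
    module I = Inverse (Bijection⇒Inverse card)
    _≈?_ : Decidable _≈_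
    _≈?_ = HasCard-≟ card
    atoms : List Carrier
    atoms = filter (nonzero? _≈?_) (cells I.to)

  module Coordinates {t} (P : AtomicPartition t) where
    open AtomicPartition P

    side : ∀ {e p} → Undivided e p → Bool
    side = [ const true , const false ]′

    side-spec : ∀ {e p} (u : Undivided e p) → p ∧ e ≈ p ∧ ⟦ side u ⟧
    side-spec (inj₁ p∧e≈p) = trans p∧e≈p (sym (∧-identityʳ _))
    side-spec (inj₂ p∧e≈⊥) = trans p∧e≈⊥ (sym (∧-zeroʳ _))

    at : Fin t → Carrier → Bool
    at k x = side (undivided k x)

    at-spec : ∀ k x → atom k ∧ x ≈ atom k ∧ ⟦ at k x ⟧
    at-spec k x = side-spec (undivided k x)

    at-unique : ∀ k {x b} → atom k ∧ x ≈ atom k ∧ ⟦ b ⟧ → at k x ≡ b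
    at-unique k {x} eq = ∧⟦⟧-injective (nonzero k) (trans (sym (at-spec k x)) eq)

    at-cong : ∀ k {x y} → x ≈ y → at k x ≡ at k y
    at-cong k {x} {y} x≈y = ≡.sym (at-unique k (trans (∧-congˡ (sym x≈y)) (at-spec k x)))

    at-⊤ : ∀ k → at k ⊤ ≡ true
    at-⊤ k = at-unique k refl

    at-∧ : ∀ k x y → at k (x ∧ y) ≡ at k x ∧ᵇ at k y
    at-∧ k x y = at-unique k (begin
      aₖ ∧ (x ∧ y)                   ≈⟨ ∧-distribˡ-∧ aₖ x y ⟩
      (aₖ ∧ x) ∧ (aₖ ∧ y)            ≈⟨ ∧-cong (at-spec k x) (at-spec k y) ⟩
      (aₖ ∧ ⟦ bx ⟧) ∧ (aₖ ∧ ⟦ by ⟧)  ≈⟨ ∧-distribˡ-∧ aₖ ⟦ bx ⟧ ⟦ by ⟧ ⟨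
      aₖ ∧ (⟦ bx ⟧ ∧ ⟦ by ⟧)         ≈⟨ ∧-congˡ (⟦⟧-∧ bx by) ⟨
      aₖ ∧ ⟦ bx ∧ᵇ by ⟧              ∎)
      where
      aₖ : Carrier
      aₖ = atom k
      bx by : Bool
      bx = at k x
      by = at k y

    at-∨ : ∀ k x y → at k (x ∨ y) ≡ at k x ∨ᵇ at k y
    at-∨ k x y = at-unique k (begin
      aₖ ∧ (x ∨ y)               ≈⟨ ∧-distribˡ-∨ aₖ x y ⟩
      aₖ ∧ x ∨ aₖ ∧ y            ≈⟨ ∨-cong (at-spec k x) (at-spec k y) ⟩
      aₖ ∧ ⟦ bx ⟧ ∨ aₖ ∧ ⟦ by ⟧  ≈⟨ ∧-distribˡ-∨ aₖ ⟦ bx ⟧ ⟦ by ⟧ ⟨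
      aₖ ∧ (⟦ bx ⟧ ∨ ⟦ by ⟧)     ≈⟨ ∧-congˡ (⟦⟧-∨ bx by) ⟨
      aₖ ∧ ⟦ bx ∨ᵇ by ⟧          ∎)
      where
      aₖ : Carrier
      aₖ = atom k
      bx by : Bool
      bx = at k x
      by = at k y

    fromBits : (Fin t → Bool) → Carrier
    fromBits g = ⋁ λ j → atom j ∧ ⟦ g j ⟧

    fromBits-cong : ∀ {g h} → (∀ k → g k ≡ h k) → fromBits g ≈ fromBits h
    fromBits-cong g≗h = sum-cong-≋ (λ j → ∧-congˡ (reflexive (≡.cong ⟦_⟧ (g≗h j))))

    at-fromBits : ∀ k g → at k (fromBits g) ≡ g k
    at-fromBits k g = at-unique k (begin
      atom k ∧ fromBits g                       ≈⟨ *-distribˡ-sum (atom k) (λ j → atom j ∧ ⟦ g j ⟧) ⟩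
      ⋁ (λ j → atom k ∧ (atom j ∧ ⟦ g j ⟧))     ≈⟨ sum-single +-commutativeMonoid _ k off-diagonal ⟩
      atom k ∧ (atom k ∧ ⟦ g k ⟧)               ≈⟨ ∧-assoc _ _ _ ⟨
      (atom k ∧ atom k) ∧ ⟦ g k ⟧               ≈⟨ ∧-congʳ (∧-idem (atom k)) ⟩
      atom k ∧ ⟦ g k ⟧                          ∎)
      where
      off-diagonal : ∀ j → j ≢ k → atom k ∧ (atom j ∧ ⟦ g j ⟧) ≈ ⊥
      off-diagonal j j≢k = trans (sym (∧-assoc _ _ _))
        (trans (∧-congʳ (disjoint (j≢k ∘ ≡.sym))) (∧-zeroˡ _))

    fromBits-at : ∀ x → fromBits (λ k → at k x) ≈ x
    fromBits-at x = begin
      ⋁ (λ k → atom k ∧ ⟦ at k x ⟧)   ≈⟨ sum-cong-≋ (λ k → trans (sym (at-spec k x)) (∧-comm _ _)) ⟩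
      ⋁ (λ k → x ∧ atom k)            ≈⟨ *-distribˡ-sum x atom ⟨
      x ∧ ⋁ atom                      ≈⟨ ∧-congˡ covering ⟩
      x ∧ ⊤                           ≈⟨ ∧-identityʳ x ⟩
      x                               ∎

    Bits↔ : Inverse (Pointwise.≋-setoid (≡.setoid Bool) t) setoid
    Bits↔ = mkInverse fromBits (λ x k → at k x) fromBits-cong (λ x≈y k → at-cong k x≈y)
      fromBits-at (λ g k → at-fromBits k g)

    carrier-card : HasCard setoid (2 ^ t)
    carrier-card = HasCard-↔ (HasCard-^ t (Inverse⇒Bijection 2↔Bool)) Bits↔

    at-≈⊤ : ∀ {x} → (∀ k → at k x ≡ true) → x ≈ ⊤
    at-≈⊤ {x} x≡true = begin
      x                        ≈⟨ fromBits-at x ⟨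
      fromBits (λ k → at k x)  ≈⟨ fromBits-cong (λ k → ≡.trans (x≡true k) (≡.sym (at-⊤ k))) ⟩
      fromBits (λ k → at k ⊤)  ≈⟨ fromBits-at ⊤ ⟩
      ⊤                        ∎

    at-condition : ∀ k {n} (z : Tuple 𝔹 n) j y →
      at k (prefixMeet 𝔹 z j ∨ y) ≡ prefixMeet 𝟚 (at k ∘ z) j ∨ᵇ at k y
    at-condition k z j y = ≡.trans (at-∨ k _ y) (≡.cong (_∨ᵇ at k y) (prefixMeet-homo 𝔹 𝟚 {at k} (at-∧ k) z j))

    InD-at : ∀ {n z} → InD 𝔹 n z → ∀ k → InD 𝟚 n (at k ∘ z)
    InD-at {z = z} (z∈B , z₀≈⊤) k =
        (λ j → ≡.trans (≡.sym (at-condition k z (inject₁ j) _)) (≈⊤⇒true (z∈B j)))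
      , ≈⊤⇒true z₀≈⊤
      where
      ≈⊤⇒true : ∀ {x} → x ≈ ⊤ → at k x ≡ true
      ≈⊤⇒true x≈⊤ = ≡.trans (at-cong k x≈⊤) (at-⊤ k)

    at-InD : ∀ {n z} → (∀ k → InD 𝟚 n (at k ∘ z)) → InD 𝔹 n z
    at-InD {z = z} atz∈D =
        (λ j → at-≈⊤ λ k → ≡.trans (at-condition k z (inject₁ j) _) (proj₁ (atz∈D k) j))
      , at-≈⊤ (proj₂ ∘ atz∈D)

    D↔ : ∀ n → Inverse (Pointwise.≋-setoid (D-setoid 𝟚 n) t) (D-setoid 𝔹 n)
    D↔ n = mkInverse to (λ (z , z∈D) k → at k ∘ z , InD-at z∈D k)
      (λ F≋G i → fromBits-cong (λ k → F≋G k i))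
      (λ z≋w k i → at-cong k (z≋w i))
      (λ (z , _) i → fromBits-at (z i))
      (λ F k i → at-fromBits k (λ k′ → proj₁ (F k′) i))
      where
      to : (Fin t → Setoid.Carrier (D-setoid 𝟚 n)) → Setoid.Carrier (D-setoid 𝔹 n)
      to F = (λ i → fromBits (column i)) , at-InD (λ k → InD-cong 𝟚 (λ i → ≡.sym (at-fromBits k (column i))) (proj₂ (F k)))
        where
        column : Fin (suc n) → Fin t → Bool
        column i k = proj₁ (F k) i

    D-card : ∀ n → HasCard (D-setoid 𝔹 n) (suc n ^ t)
    D-card n = HasCard-↔ (HasCard-^ t (D-𝟚-card n)) (D↔ n)

theorem5p5 : ∀ {c ℓ} (𝔹 : BooleanAlgebra c ℓ) (n m : ℕ) (hn : 1 ≤ n) → 1 ≤ m →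
    HasCard (BooleanAlgebra.setoid 𝔹) (2 ^ m) →
    HasCard (D-setoid 𝔹 n) ((n + 1) ^ m) × HasCard (Boo-setoid 𝔹 n hn) (2 ^ m)
theorem5p5 𝔹 n@(suc n′) m (s≤s z≤n) _ card =
    ≡.subst (HasCard (D-setoid 𝔹 n)) (≡.cong₂ _^_ (+-comm 1 n) t≡m) (D-card n)
  , HasCard-↔ card (Boo↔ 𝔹 n′)
  where
  partition : Σ ℕ (AtomicPartition 𝔹)
  partition = finite⇒atomicPartition 𝔹 card
  open Coordinates 𝔹 (proj₂ partition)
  t≡m : proj₁ partition ≡ m
  t≡m = ^-injectiveʳ 2 (s≤s (s≤s z≤n)) (HasCard-unique carrier-card card)
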